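{- Consider online unweighted interval selection with revocable decisions on instances in which all intervals have the same length $L$, arriving in uniformly random order, and a deterministic memoryless algorithm described by functions $F_l,F_r:(0,L)\to\{0,1\}$ satisfying $F_l(v)=1$ and $F_r(v)=0$ for all $v\le L/2$. If there exists $\gamma>L/2$ with $F_r(\gamma)=1$, then the adversary can force a competitive ratio of $2$: there are single-length instances on which, with high probability (probability tending to $1$ as the number of duplicate copies of an interval in the instance grows), the algorithm ends with one interval while $\mathrm{OPT}=2$.
   Context: Intervals are half-open $[s,f)$; two intervals conflict if they intersect. Intervals arrive one at a time; the algorithm maintains a set of pairwise non-conflicting intervals, may take a new interval while discarding conflicting current ones, and discarded or rejected intervals cannot be taken again. A deterministic memoryless algorithm decides on each arriving interval using only that interval and its current solution. When the current solution is a single interval $I_{old}=[s_{old},f_{old})$ and the new interval $I_{new}=[s_{new},f_{new})$ of the same length partially overlaps it, the conflict is on the left of $I_{old}$ if $s_{new}<s_{old}<f_{new}$ (overlap $v=f_{new}-s_{old}$) and on the right if $s_{new}<f_{old}<f_{new}$ (overlap $v=f_{old}-s_{new}$); $F_l(v)\in\{0,1\}$ (resp. $F_r(v)$) indicates whether the algorithm replaces $I_{old}$ by $I_{new}$ for a left (resp. right) conflict with overlap $v$. A new interval conflicting with more than one current interval is not taken. $\mathrm{OPT}$ is the maximum number of pairwise disjoint intervals of the instance and the competitive ratio is $\mathrm{OPT}/\mathrm{ALG}$ with high probability.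
   Formalization: The interval endpoints, the length $L$, the overlap γ and the overlaps on which $F_l$ and $F_r$ are defined are rational rather than real. -}

module Defs where

open import Data.Bool using (Bool; true; false; if_then_else_; not)
open import Data.Nat as ℕ using (ℕ; suc)
open import Data.List using (List; []; _∷_; map; concatMap; filter; foldl; length)
open import Data.List.Relation.Unary.All using (All)
open import Data.List.Relation.Binary.Sublist.Propositional using (_⊆_)
open import Data.Product using (_×_; ∃-syntax; Σ-syntax)
open import Data.Rational using (ℚ; _<_; _-_)
open import Data.Rational.Properties using (_<?_)
open import Relation.Nullary using (¬_)
open import Relation.Nullary.Decidable using (_×-dec_; ¬?; ⌊_⌋)
open import Relation.Binary.PropositionalEquality using (_≡_)

-- A half-open interval [s , f) with rational endpoints.
record Interval : Set where
  constructor [_,_⟩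
  field
    s : ℚ
    f : ℚ
open Interval public

len : Interval → ℚ
len I = f I - s I

Conflict : Interval → Interval → Set
Conflict I J = (s I < f J) × (s J < f I)

conflict? : Interval → Interval → Bool
conflict? I J = ⌊ (s I <? f J) ×-dec (s J <? f I) ⌋

conflicting : Interval → List Interval → List Interval
conflicting I sol = filter (λ J → (s I <? f J) ×-dec (s J <? f I)) sol

nonConflicting : Interval → List Interval → List Interval
nonConflicting I sol = filter (λ J → ¬? ((s I <? f J) ×-dec (s J <? f I))) sol

data Independent : List Interval → Set where
  []  : Independent []
  _∷_ : ∀ {I S} → All (λ J → ¬ Conflict I J) S → Independent S → Independent (I ∷ S)

OPTis : List Interval → ℕ → Set
OPTis inst n =
  (∃[ S ] (S ⊆ inst × Independent S × length S ≡ n)) ×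
  (∀ S → S ⊆ inst → Independent S → length S ℕ.≤ n)

-- A deterministic memoryless algorithm: decides on an arriving interval using
-- only that interval and its current solution (true = take it).
Decision : Set
Decision = Interval → List Interval → Bool

step : Decision → List Interval → Interval → List Interval
step D sol I = if D I sol then I ∷ nonConflicting I sol else sol

run : Decision → List Interval → List Interval
run D order = foldl (step D) [] order

-- All arrival orders of a list (copies treated as distinct items: n! orders,
-- each equally likely under a uniformly random arrival order).
insertions : {A : Set} → A → List A → List (List A)
insertions x [] = (x ∷ []) ∷ []
insertions x (y ∷ ys) = (x ∷ y ∷ ys) ∷ map (y ∷_) (insertions x ys)

orders : {A : Set} → List A → List (List A)
orders [] = [] ∷ []
orders (x ∷ xs) = concatMap (insertions x) (orders xs)

badOrders : Decision → List Interval → ℕ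
badOrders D inst = length (filter (λ σ → ¬? (length (run D σ) ℕ.≟ 1)) (orders inst))

{-# OPTIONS --safe #-}
-- Take P = [0, L), Q = [L, 2L) and k copies of M = [δ, L + δ) with δ = L - γ, so OPT = 2.
-- An arriving M displaces a lone P (right conflict with overlap γ, F_r(γ) = 1) and a lone Q
-- (left conflict with overlap δ ≤ L/2, F_l(δ) = 1), and against a lone M any interval either
-- replaces it or is rejected.  Hence the solution stays a single interval unless P and Q arrive
-- back to back, which happens in at most 2 (k+1)! of the (k+2)! arrival orders.
module Submission where

open import Defs
open import Data.Bool using (Bool; true; false)
open import Data.Nat using (ℕ; zero; suc; _≤_; _*_; _+_; z≤n; s≤s; _≟_)
open import Data.Nat.Properties
  using (≤-refl; ≤-trans; ≤-reflexive; n≤1+n; m≤n⇒m≤1+n; +-mono-≤; *-monoʳ-≤; module ≤-Reasoning)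
open import Algebra.Properties.CommutativeSemigroup Data.Nat.Properties.*-commutativeSemigroup
  using (x∙yz≈y∙xz)
open import Data.List using (List; []; _∷_; length; _++_; map; concatMap; filter; foldl; replicate)
open import Data.List.Properties using (filter-reject; filter-++; length-++; length-map; length-replicate)
open import Data.List.Relation.Unary.All as All using (All; []; _∷_)
open import Data.List.Relation.Unary.All.Properties using (map⁺; concat⁺; replicate⁺)
open import Data.List.Relation.Binary.Sublist.Propositional using (_⊆_; _∷_; _∷ʳ_; minimum)
open import Data.List.Relation.Binary.Sublist.Propositional.Properties using (All-resp-⊆)
open import Data.Product using (_×_; _,_; ∃-syntax; Σ-syntax; swap)
open import Data.Sum using (_⊎_; inj₁; inj₂; [_,_]′)
open import Function using (id)
open import Data.Empty using (⊥-elim)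
open import Data.Rational using (ℚ; 0ℚ; ½; -_) renaming (_<_ to _<ℚ_; _≤_ to _≤ℚ_; _*_ to _*ℚ_; _-_ to _-ℚ_; _+_ to _+ℚ_)
import Data.Rational.Properties as ℚ
open import Data.Rational.Solver using (module +-*-Solver)
open import Level using (0ℓ)
open import Relation.Nullary using (¬_; does)
open import Relation.Nullary.Decidable using (¬?; _×-dec_)
open import Relation.Unary using (Pred; Decidable)
open import Relation.Binary.PropositionalEquality using (_≡_; refl; sym; trans; cong; cong₂; subst)

open +-*-Solver

data AllBut {A : Set} (P : Pred A 0ℓ) : ℕ → List A → Set where
  []   : ∀ {n} → AllBut P n []
  _∷_  : ∀ {n x xs} → P x → AllBut P n xs → AllBut P n (x ∷ xs)
  _∷ʳ_ : ∀ {n xs} x → AllBut P n xs → AllBut P (suc n) (x ∷ xs)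

module _ {A : Set} where

  All⇒AllBut : ∀ {P : Pred A 0ℓ} {n xs} → All P xs → AllBut P n xs
  All⇒AllBut []       = []
  All⇒AllBut (p ∷ ps) = p ∷ All⇒AllBut ps

  AllBut-map⁺ : ∀ {B : Set} {P : Pred A 0ℓ} {R : Pred B 0ℓ} {f : A → B} {n xs} →
                (∀ {x} → P x → R (f x)) → AllBut P n xs → AllBut R n (map f xs)
  AllBut-map⁺ g []        = []
  AllBut-map⁺ g (p ∷ ps)  = g p ∷ AllBut-map⁺ g ps
  AllBut-map⁺ g (x ∷ʳ ps) = _ ∷ʳ AllBut-map⁺ g ps

  length-filter-∷ : ∀ {Q : Pred A 0ℓ} (Q? : Decidable Q) x xs →
                    length (filter Q? (x ∷ xs)) ≤ suc (length (filter Q? xs))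
  length-filter-∷ Q? x xs with does (Q? x)
  ... | true  = ≤-refl
  ... | false = n≤1+n _

  AllBut⇒length-filter≤ : ∀ {P Q : Pred A 0ℓ} (Q? : Decidable Q) → (∀ {x} → P x → ¬ Q x) →
                          ∀ {n xs} → AllBut P n xs → length (filter Q? xs) ≤ n
  AllBut⇒length-filter≤ Q? P⇒¬Q []         = z≤n
  AllBut⇒length-filter≤ Q? P⇒¬Q (p ∷ ps)   =
    ≤-trans (≤-reflexive (cong length (filter-reject Q? (P⇒¬Q p))))
            (AllBut⇒length-filter≤ Q? P⇒¬Q ps)
  AllBut⇒length-filter≤ Q? P⇒¬Q (x ∷ʳ ps) =
    ≤-trans (length-filter-∷ Q? x _) (s≤s (AllBut⇒length-filter≤ Q? P⇒¬Q ps))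

  length-filter-concatMap≤ : ∀ {B : Set} {Q : Pred B 0ℓ} (Q? : Decidable Q) (f : A → List B) c {xs} →
                             All (λ x → length (filter Q? (f x)) ≤ c) xs →
                             length (filter Q? (concatMap f xs)) ≤ length xs * c
  length-filter-concatMap≤ Q? f c []               = z≤n
  length-filter-concatMap≤ Q? f c {x ∷ xs} (h ∷ hs) = begin
    length (filter Q? (f x ++ concatMap f xs))
      ≡⟨ cong length (filter-++ Q? (f x) _) ⟩
    length (filter Q? (f x) ++ filter Q? (concatMap f xs))
      ≡⟨ length-++ (filter Q? (f x)) ⟩
    length (filter Q? (f x)) + length (filter Q? (concatMap f xs))
      ≤⟨ +-mono-≤ h (length-filter-concatMap≤ Q? f c hs) ⟩
    c + length xs * c ∎
    where open ≤-Reasoning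

  length-concatMap : ∀ {B : Set} (f : A → List B) r {xs} → All (λ x → length (f x) ≡ r) xs →
                     length (concatMap f xs) ≡ length xs * r
  length-concatMap f r []               = refl
  length-concatMap f r {x ∷ xs} (h ∷ hs) =
    trans (length-++ (f x)) (cong₂ _+_ h (length-concatMap f r hs))

  length-insertions : ∀ (x : A) ys → length (insertions x ys) ≡ suc (length ys)
  length-insertions x []       = refl
  length-insertions x (y ∷ ys) =
    cong suc (trans (length-map (y ∷_) (insertions x ys)) (length-insertions x ys))

  insertions-replicate : ∀ (x : A) k → All (_≡ replicate (suc k) x) (insertions x (replicate k x))
  insertions-replicate x zero    = refl ∷ []
  insertions-replicate x (suc k) = refl ∷ map⁺ (All.map (cong (x ∷_)) (insertions-replicate x k))

  orders-replicate : ∀ (x : A) k → All (_≡ replicate k x) (orders (replicate k x))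
  orders-replicate x zero    = refl ∷ []
  orders-replicate x (suc k) =
    concat⁺ (map⁺ (All.map (λ { refl → insertions-replicate x k }) (orders-replicate x k)))

x<x+y : ∀ x {y} → 0ℚ <ℚ y → x <ℚ x +ℚ y
x<x+y x 0<y = subst (_<ℚ x +ℚ _) (ℚ.+-identityʳ x) (ℚ.+-monoʳ-< x 0<y)

module _ (D : Decision) where

  step-taken : ∀ {X Y} → Conflict X Y → D X (Y ∷ []) ≡ true → step D (Y ∷ []) X ≡ X ∷ []
  step-taken {X} X#Y taken rewrite taken =
    cong (X ∷_) (filter-reject (λ J → ¬? ((s X ℚ.<? f J) ×-dec (s J ℚ.<? f X))) (λ X∦Y → X∦Y X#Y))

  step-singleton : ∀ {X Y} → Conflict X Y →
                   step D (Y ∷ []) X ≡ X ∷ [] ⊎ step D (Y ∷ []) X ≡ Y ∷ []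
  step-singleton {X} {Y} X#Y = by-decision (D X (Y ∷ [])) refl
    where
    by-decision : ∀ b → D X (Y ∷ []) ≡ b →
                  step D (Y ∷ []) X ≡ X ∷ [] ⊎ step D (Y ∷ []) X ≡ Y ∷ []
    by-decision true  taken    = inj₁ (step-taken X#Y taken)
    by-decision false rejected rewrite rejected = inj₂ refl

module Instance (L : ℚ) (0<L : 0ℚ <ℚ L) (γ : ℚ) (½L<γ : ½ *ℚ L <ℚ γ) (γ<L : γ <ℚ L) where

  δ : ℚ
  δ = L -ℚ γ

  P M Q : Interval
  P = [ 0ℚ , L ⟩
  M = [ δ , L +ℚ δ ⟩
  Q = [ L , L +ℚ L ⟩

  len-P : len P ≡ L
  len-P = solve 1 (λ L → L :- con 0ℚ := L) refl L

  len-M : len M ≡ L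
  len-M = solve 2 (λ L d → (L :+ d) :- d := L) refl L δ

  len-Q : len Q ≡ L
  len-Q = solve 1 (λ L → (L :+ L) :- L := L) refl L

  overlap-P-M : f P -ℚ s M ≡ γ
  overlap-P-M = solve 2 (λ L g → L :- (L :- g) := g) refl L γ

  overlap-M-Q : f M -ℚ s Q ≡ δ
  overlap-M-Q = solve 2 (λ L d → (L :+ d) :- L := d) refl L δ

  0<δ : 0ℚ <ℚ δ
  0<δ = subst (_<ℚ δ) (ℚ.+-inverseʳ γ) (ℚ.+-monoˡ-< (- γ) γ<L)

  δ≤½L : δ ≤ℚ ½ *ℚ L
  δ≤½L = ℚ.<⇒≤ (subst (δ <ℚ_) (solve 1 (λ L → L :- con ½ :* L := con ½ :* L) refl L)
                       (ℚ.+-monoʳ-< L (ℚ.neg-antimono-< ½L<γ)))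

  δ<L : δ <ℚ L
  δ<L = subst (δ <ℚ_) (solve 2 (λ L g → (L :- g) :+ g := L) refl L γ)
              (x<x+y δ (ℚ.<-trans 0<½L ½L<γ))
    where
    0<½L : 0ℚ <ℚ ½ *ℚ L
    0<½L = subst (_<ℚ ½ *ℚ L) (ℚ.*-zeroʳ ½) (ℚ.*-monoʳ-<-pos ½ 0<L)

  L<L+δ : L <ℚ L +ℚ δ
  L<L+δ = x<x+y L 0<δ

  P#M : Conflict P M
  P#M = ℚ.<-trans 0<L L<L+δ , δ<L

  Q#M : Conflict Q M
  Q#M = L<L+δ , ℚ.<-trans δ<L (x<x+y L 0<L)

  M#M : Conflict M M
  M#M = ℚ.<-trans δ<L L<L+δ , ℚ.<-trans δ<L L<L+δ

  P∦Q : ¬ Conflict P Q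
  P∦Q (_ , L<L) = ℚ.<-irrefl refl L<L

  inst : ℕ → List Interval
  inst k = P ∷ Q ∷ replicate k M

  inst-len : ∀ k → All (λ I → len I ≡ L) (inst k)
  inst-len k = len-P ∷ len-Q ∷ replicate⁺ k len-M

  alone-beside-Ms : ∀ {I S} → Conflict I M → All (_≡ M) S →
                    All (λ J → ¬ Conflict I J) S → length S ≡ 0
  alone-beside-Ms I#M []         []         = refl
  alone-beside-Ms I#M (refl ∷ _) (I∦M ∷ _) = ⊥-elim (I∦M I#M)

  independent-Ms≤1 : ∀ {S} → All (_≡ M) S → Independent S → length S ≤ 1
  independent-Ms≤1 []           []          = z≤n
  independent-Ms≤1 (refl ∷ S≡M) (M∦S ∷ _) = s≤s (≤-reflexive (alone-beside-Ms M#M S≡M M∦S))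

  inst-OPT : ∀ k → OPTis (inst k) 2
  inst-OPT k = (P ∷ Q ∷ [] , refl ∷ refl ∷ minimum _ , (P∦Q ∷ []) ∷ [] ∷ [] , refl) , independent≤2
    where
    Ms : ∀ {S} → S ⊆ replicate k M → All (_≡ M) S
    Ms S⊆ = All-resp-⊆ S⊆ (replicate⁺ k refl)

    independent≤2 : ∀ S → S ⊆ inst k → Independent S → length S ≤ 2
    independent≤2 (P ∷ Q ∷ S) (refl ∷ refl ∷ S⊆) (_ ∷ Q∦S ∷ _) =
      s≤s (s≤s (≤-reflexive (alone-beside-Ms Q#M (Ms S⊆) Q∦S)))
    independent≤2 (P ∷ S) (refl ∷ _ ∷ʳ S⊆) (P∦S ∷ _) =
      s≤s (m≤n⇒m≤1+n (≤-reflexive (alone-beside-Ms P#M (Ms S⊆) P∦S)))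
    independent≤2 (Q ∷ S) (_ ∷ʳ refl ∷ S⊆) (Q∦S ∷ _) =
      s≤s (m≤n⇒m≤1+n (≤-reflexive (alone-beside-Ms Q#M (Ms S⊆) Q∦S)))
    independent≤2 S (_ ∷ʳ _ ∷ʳ S⊆) S-ind = m≤n⇒m≤1+n (independent-Ms≤1 (Ms S⊆) S-ind)

  data Letter : Interval → Set where
    isP : Letter P
    isQ : Letter Q
    isM : Letter M

  Letter#M : ∀ {X} → Letter X → Conflict X M
  Letter#M isP = P#M
  Letter#M isQ = Q#M
  Letter#M isM = M#M

  data Single : List Interval → Set where
    [_] : ∀ {X} → Letter X → Single (X ∷ [])

  Single-length : ∀ {sol} → Single sol → length sol ≡ 1
  Single-length [ _ ] = refl

  data Spaced : List Interval → Set where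
    []      : Spaced []
    M∷_     : ∀ {w} → Spaced w → Spaced (M ∷ w)
    M∷[_]∷_ : ∀ {X w} → Letter X → Spaced w → Spaced (M ∷ X ∷ w)

  data Playable : List Interval → Set where
    lead   : ∀ {X w} → Letter X → Spaced w → Playable (X ∷ w)
    M-lead : ∀ {X w} → Letter X → Spaced w → Playable (M ∷ X ∷ w)

  M∷-Playable : ∀ {σ} → Playable σ → Playable (M ∷ σ)
  M∷-Playable (lead x w)   = M-lead x w
  M∷-Playable (M-lead x w) = lead isM (M∷[ x ]∷ w)

  Ms-Spaced : ∀ {w} → All (_≡ M) w → Spaced w
  Ms-Spaced []         = []
  Ms-Spaced (refl ∷ w) = M∷ Ms-Spaced w

  data OneQ : List Interval → Set where
    Q∷_ : ∀ {w} → All (_≡ M) w → OneQ (Q ∷ w)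
    M∷_ : ∀ {τ} → OneQ τ → OneQ (M ∷ τ)

  M∷OneQ-Spaced : ∀ {τ} → OneQ τ → Spaced (M ∷ τ)
  M∷OneQ-Spaced (Q∷ w) = M∷[ isQ ]∷ Ms-Spaced w
  M∷OneQ-Spaced (M∷ τ) = M∷ M∷OneQ-Spaced τ

  M∷insertions-P-Ms-Spaced : ∀ {w} → All (_≡ M) w → All (λ ρ → Spaced (M ∷ ρ)) (insertions P w)
  M∷insertions-P-Ms-Spaced []         = (M∷[ isP ]∷ []) ∷ []
  M∷insertions-P-Ms-Spaced (refl ∷ w) =
    (M∷[ isP ]∷ M∷ Ms-Spaced w) ∷ map⁺ (All.map M∷_ (M∷insertions-P-Ms-Spaced w))

  insertions-P-Playable : ∀ {τ} → OneQ τ → AllBut Playable 2 (insertions P τ)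
  insertions-P-Playable {Q ∷ w} (Q∷ w≡M) = (P ∷ Q ∷ w) ∷ʳ AllBut-map⁺ (λ p → p) (after-Q w≡M)
    where
    after-Q : ∀ {w} → All (_≡ M) w → AllBut (λ ρ → Playable (Q ∷ ρ)) 1 (insertions P w)
    after-Q []         = (P ∷ []) ∷ʳ []
    after-Q (refl ∷ w) =
      _ ∷ʳ All⇒AllBut (map⁺ (All.map (lead isQ) (M∷insertions-P-Ms-Spaced w)))
  insertions-P-Playable (M∷ τ) =
    lead isP (M∷OneQ-Spaced τ) ∷ AllBut-map⁺ M∷-Playable (insertions-P-Playable τ)

  QM-orders : ℕ → List (List Interval)
  QM-orders k = orders (Q ∷ replicate k M)

  QM-orders-OneQ-length : ∀ k → All (λ τ → OneQ τ × length τ ≡ suc k) (QM-orders k)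
  QM-orders-OneQ-length k =
    concat⁺ (map⁺ (All.map (λ { refl → Q-into-Ms }) (orders-replicate M k)))
    where
    insertions-Q-Ms : ∀ {w} → All (_≡ M) w → All (λ τ → OneQ τ × length τ ≡ suc (length w)) (insertions Q w)
    insertions-Q-Ms []         = (Q∷ [] , refl) ∷ []
    insertions-Q-Ms (refl ∷ w) =
      (Q∷ (refl ∷ w) , refl) ∷ map⁺ (All.map (λ { (τ , n) → M∷ τ , cong suc n }) (insertions-Q-Ms w))

    Q-into-Ms : All (λ τ → OneQ τ × length τ ≡ suc k) (insertions Q (replicate k M))
    Q-into-Ms = subst (λ n → All (λ τ → OneQ τ × length τ ≡ suc n) (insertions Q (replicate k M)))
                      (length-replicate k) (insertions-Q-Ms (replicate⁺ k refl))

  orders-inst-length : ∀ k → length (orders (inst k)) ≡ length (QM-orders k) * suc (suc k)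
  orders-inst-length k = length-concatMap (insertions P) (suc (suc k))
    (All.map (λ { {τ} (_ , n) → trans (length-insertions P τ) (cong suc n) }) (QM-orders-OneQ-length k))

  module Algorithm (D : Decision)
    (take-free : ∀ I sol → length (conflicting I sol) ≡ 0 → D I sol ≡ true)
    (M-displaces-P : D M (P ∷ []) ≡ true) (M-displaces-Q : D M (Q ∷ []) ≡ true) where

    step-[] : ∀ X → step D [] X ≡ X ∷ []
    step-[] X rewrite take-free X [] refl = refl

    step-M : ∀ {sol} → Single sol → step D sol M ≡ M ∷ []
    step-M [ isP ] = step-taken D {M} {P} (swap P#M) M-displaces-P
    step-M [ isQ ] = step-taken D {M} {Q} (swap Q#M) M-displaces-Q
    step-M [ isM ] = [ id , id ]′ (step-singleton D {M} {M} M#M)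

    step-after-M : ∀ {X} → Letter X → Single (step D (M ∷ []) X)
    step-after-M {X} x = [ (λ X-taken → subst Single (sym X-taken) [ x ])
                         , (λ X-rejected → subst Single (sym X-rejected) [ isM ]) ]′
                         (step-singleton D {X} {M} (Letter#M x))

    Spaced-stays-Single : ∀ {sol w} → Single sol → Spaced w → Single (foldl (step D) sol w)
    Spaced-stays-Single {sol} single [] = single
    Spaced-stays-Single {sol} single (M∷_ {w} sp) =
      subst (λ t → Single (foldl (step D) t w)) (sym (step-M single))
            (Spaced-stays-Single [ isM ] sp)
    Spaced-stays-Single {sol} single (M∷[_]∷_ {X} {w} x sp) =
      subst (λ t → Single (foldl (step D) (step D t X) w)) (sym (step-M single))
            (Spaced-stays-Single (step-after-M x) sp)

    Playable-run : ∀ {σ} → Playable σ → Single (run D σ)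
    Playable-run (lead {X} {w} x sp) =
      subst (λ t → Single (foldl (step D) t w)) (sym (step-[] X)) (Spaced-stays-Single [ x ] sp)
    Playable-run (M-lead {X} {w} x sp) =
      subst (λ t → Single (foldl (step D) (step D t X) w)) (sym (step-[] M))
            (Spaced-stays-Single (step-after-M x) sp)

    bad? : Decidable (λ σ → ¬ length (run D σ) ≡ 1)
    bad? σ = ¬? (length (run D σ) ≟ 1)

    bad-insertions-P≤2 : ∀ {τ} → OneQ τ → length (filter bad? (insertions P τ)) ≤ 2
    bad-insertions-P≤2 τ = AllBut⇒length-filter≤ bad? (λ σ bad → bad (Single-length (Playable-run σ)))
                                                 (insertions-P-Playable τ)

    badOrders-inst : ∀ k → badOrders D (inst k) ≤ length (QM-orders k) * 2
    badOrders-inst k = length-filter-concatMap≤ bad? (insertions P) 2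
      (All.map (λ { (τ , _) → bad-insertions-P≤2 τ }) (QM-orders-OneQ-length k))

    bad-orders-rare : ∀ m → ∃[ K ] (∀ k → K ≤ k →
                        suc m * badOrders D (inst k) ≤ length (orders (inst k)))
    bad-orders-rare m = m * 2 , λ k m*2≤k → let t = length (QM-orders k) in begin
      suc m * badOrders D (inst k) ≤⟨ *-monoʳ-≤ (suc m) (badOrders-inst k) ⟩
      suc m * (t * 2)              ≡⟨ x∙yz≈y∙xz (suc m) t 2 ⟩
      t * (suc m * 2)              ≤⟨ *-monoʳ-≤ t (s≤s (s≤s m*2≤k)) ⟩
      t * suc (suc k)              ≡⟨ sym (orders-inst-length k) ⟩
      length (orders (inst k))     ∎
      where open ≤-Reasoning

lemma6 : (L : ℚ) → 0ℚ <ℚ L →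
    (D : Decision) (Fl Fr : ℚ → Bool) →
    -- a new interval conflicting with no current interval is taken
    (∀ I sol → length (conflicting I sol) ≡ 0 → D I sol ≡ true) →
    -- a new interval conflicting with more than one current interval is not taken
    (∀ I sol → 2 ≤ length (conflicting I sol) → D I sol ≡ false) →
    -- single current interval, same length L, left conflict with overlap v = f_new - s_old
    (∀ Inew Iold → len Inew ≡ L → len Iold ≡ L →
       s Inew <ℚ s Iold → s Iold <ℚ f Inew →
       D Inew (Iold ∷ []) ≡ Fl (f Inew -ℚ s Iold)) →
    -- single current interval, same length L, right conflict with overlap v = f_old - s_new
    (∀ Inew Iold → len Inew ≡ L → len Iold ≡ L →
       s Inew <ℚ f Iold → f Iold <ℚ f Inew →
       D Inew (Iold ∷ []) ≡ Fr (f Iold -ℚ s Inew)) →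
    (∀ v → 0ℚ <ℚ v → v ≤ℚ ½ *ℚ L → Fl v ≡ true) →
    (∀ v → 0ℚ <ℚ v → v ≤ℚ ½ *ℚ L → Fr v ≡ false) →
    (∃[ γ ] (½ *ℚ L <ℚ γ × γ <ℚ L × Fr γ ≡ true)) →
    Σ[ inst ∈ (ℕ → List Interval) ] ((∀ k → All (λ I → len I ≡ L) (inst k)) ×
               (∀ k → OPTis (inst k) 2) ×
               -- Pr[ALG does not end with exactly one interval] → 0 as k → ∞
               (∀ m → ∃[ K ] (∀ k → K ≤ k →
                  suc m * badOrders D (inst k) ≤ length (orders (inst k)))))
lemma6 L 0<L D Fl Fr take-free _ left right Fl-short _ (γ , ½L<γ , γ<L , Frγ) =
  inst , inst-len , inst-OPT , bad-orders-rare
  where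
  open Instance L 0<L γ ½L<γ γ<L
  open Algorithm D take-free
    (trans (right M P len-M len-P δ<L L<L+δ) (trans (cong Fr overlap-P-M) Frγ))
    (trans (left M Q len-M len-Q δ<L L<L+δ) (trans (cong Fl overlap-M-Q) (Fl-short δ 0<δ δ≤½L)))
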